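{- Let $p$ be a prime and $n\ge 1$ an integer. Let $v_1,\dots,v_{3n}\in\mathbb{F}_p^2\setminus\{\mathbf 0\}$, write $v_i=\binom{v_i(1)}{v_i(2)}$, and assume $v_1(2)v_2(2)\cdots v_n(2)\ne 0$ and that no $n+1$ of the vectors $v_1,\dots,v_{3n}$ lie in the same projective class. Then there exist distinct indices $i_1,\dots,i_n\in\{n+1,\dots,3n\}$ such that \[ \sum_{\substack{I\in\{1,2\}^{2n}\\ \#\{i:\,I(i)=1\}=n}}\ \prod_{i=1}^n v_i(I(i))\prod_{j=1}^n v_{i_j}(I(n+j))\ne 0 \quad\text{in }\mathbb{F}_p. \]
   Context: Two nonzero vectors $u,w\in\mathbb{F}_p^2$ lie in the same projective class if $u=\lambda w$ for some $\lambda\in\mathbb{F}_p^{\times}$. Here $I(i)$ denotes the $i$-th coordinate of $I\in\{1,2\}^{2n}$. -}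

module Defs where

open import Data.Nat using (ℕ; zero; suc; _+_; _*_; _≤_)
open import Data.Nat.Primality using (Prime)
open import Data.Fin using (Fin; toℕ; _↑ˡ_; _↑ʳ_)
import Data.Fin as F
open import Data.List using (List; []; _∷_; map; concatMap; filter; allFin)
open import Data.Nat.ListAction using (sum; product)
open import Data.Vec.Functional using (Vector) renaming (_∷_ to _∷ᶠ_)
open import Data.Product using (Σ; _×_; ∃)
open import Relation.Binary.PropositionalEquality using (_≡_; _≢_)
open import Relation.Nullary using (¬_)
import Data.Nat as N
import Data.Integer as Z
open import Data.Integer.Divisibility using () renaming (_∣_ to _∣ℤ_)

-- Elements of 𝔽_p are represented by their canonical residues Fin p;
-- vectors in 𝔽_p² as functions Fin 2 → Fin p (index 0 = coordinate 1,
-- index 1 = coordinate 2).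
Vec2 : ℕ → Set
Vec2 p = Fin 2 → Fin p

_≡[_]_ : ℕ → ℕ → ℕ → Set
a ≡[ p ] b = Z.+ p ∣ℤ (Z.+ a Z.- Z.+ b)

NonZeroVec : ∀ {p} → Vec2 p → Set
NonZeroVec v = ¬ (∀ k → toℕ (v k) ≡ 0)

SameClass : ∀ {p} → Vec2 p → Vec2 p → Set
SameClass {p} u w = Σ (Fin p) λ c → (toℕ c ≢ 0) ×
  (∀ k → toℕ (u k) ≡[ p ] (toℕ c * toℕ (w k)))

allIdx : (m : ℕ) → List (Fin m → Fin 2)
allIdx zero = (λ ()) ∷ []
allIdx (suc m) = concatMap (λ f → map (λ c → c ∷ᶠ f) (allFin 2)) (allIdx m)

numOnes : ∀ {m} → (Fin m → Fin 2) → ℕ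
numOnes {m} I = sum (map (λ i → isOne (I i)) (allFin m))
  where
  isOne : Fin 2 → ℕ
  isOne F.zero = 1
  isOne (F.suc _) = 0

balancedIdx : (n : ℕ) → List (Fin (n + n) → Fin 2)
balancedIdx n = filter (λ I → numOnes I N.≟ n) (allIdx (n + n))

-- The sum of the statement, computed in ℕ from the residues
-- (reduction ℕ → 𝔽_p is a ring homomorphism, so "≠ 0 in 𝔽_p" is "¬ p ∣ S").
-- v indexed by Fin (n + (n + n)): first n are v_1..v_n (inject+),
-- the rest v_{n+1}..v_{3n} (raise n); g j ∈ Fin (n + n) picks i_{j}.
theSum : ∀ {p} (n : ℕ) → (Fin (n + (n + n)) → Vec2 p) → (Fin n → Fin (n + n)) → ℕ
theSum n v g = sum (map term (balancedIdx n))
  where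
  term : (Fin (n + n) → Fin 2) → ℕ
  term I = product (map (λ i → toℕ (v (i ↑ˡ (n + n)) (I (i ↑ˡ n)))) (allFin n))
         * product (map (λ j → toℕ (v (n ↑ʳ g j) (I (n ↑ʳ j)))) (allFin n))

-- The sum is the coefficient of xⁿ in the product of the linear forms vᵢ(1) x + vᵢ(2) over
-- v₁, …, vₙ and the chosen vectors. Choose the vectors one at a time, keeping some coefficient
-- of index between the number already chosen and n nonzero mod p; at the start the constant
-- coefficient ∏ vᵢ(2) is such a coefficient. Adding u to a product with coefficients c turns
-- c_{r+1} into u(1) c_r + u(2) c_{r+1}, so if no unused vector can be added, every unused u
-- annihilates one fixed pair (c_r, c_{r+1}) that is nonzero mod p. Then all unused vectors,
-- of which there are at least n + 1, are proportional.
module Submission where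

open import Defs
open import Data.Bool.Base using (true; false; if_then_else_)
open import Data.Empty using (⊥-elim)
open import Data.Fin using (Fin; toℕ; _↑ˡ_; _↑ʳ_)
import Data.Fin as F
import Data.Fin.Properties as Fin
open import Data.Integer as ℤ using (ℤ; +_)
import Data.Integer.Properties as ℤ
open import Data.Integer.Divisibility.Signed
  using (∣ᵤ⇒∣; ∣⇒∣ᵤ; ∣-refl; ∣m⇒∣-m; ∣n⇒∣m*n; ∣m∣n⇒∣m+n; ∣m∣n⇒∣m-n)
  renaming (_∣_ to _∣ᶻ_)
open import Data.Integer.DivMod using (_%ℕ_; _/ℕ_; n%ℕd<d; a≡a%ℕn+[a/ℕn]*n)
open import Data.Integer.Tactic.RingSolver using (solve-∀)
open import Data.List using (List; []; _∷_; _++_; map; filter; concatMap; allFin; tabulate)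
open import Data.List.Properties using (map-++; map-cong; map-tabulate; tabulate-cong; ++-identityʳ)
open import Data.List.Relation.Unary.All using (All; []; _∷_)
open import Data.List.Relation.Unary.All.Properties using (tabulate⁺)
open import Data.Nat
  using (ℕ; zero; suc; _+_; _*_; _≤_; _<_; s≤s; z≤n; _≡ᵇ_; NonZero; ≢-nonZero; nonTrivial⇒≢1)
import Data.Nat.Properties as ℕ
open import Data.Nat.Coprimality using (prime⇒coprime; coprime-Bézout)
open import Data.Nat.Divisibility using (_∣_; _∣?_; _∣0; ∣⇒≤; n∣m*n; ∣1⇒≡1)
open import Data.Nat.GCD using (module Bézout)
open import Data.Nat.ListAction using (sum; product)
open import Data.Nat.ListAction.Properties using (sum-++; product-++)
open import Data.Nat.Primality using (Prime; euclidsLemma; prime⇒nonZero; prime⇒nonTrivial)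
open import Data.Nat.Solver using (module +-*-Solver)
open import Data.Product using (Σ; _×_; _,_; proj₁; proj₂)
open import Data.Sum as Sum using (_⊎_; inj₁; inj₂)
open import Data.Vec.Functional using (Vector; toList) renaming (_∷_ to _∷ᶠ_; _++_ to _++ᶠ_)
open import Data.Vec.Functional.Properties using (lookup-++ˡ; lookup-++ʳ)
open import Function using (_∘_)
open import Function.Definitions using (Injective)
open import Relation.Binary.PropositionalEquality
open import Relation.Nullary using (¬_; Dec; yes; no; ¬?; _×-dec_)

open +-*-Solver using (solve; _:=_; _:+_; _:*_; con)
open ≡-Reasoning

private variable
  A B : Set

sum-map-concatMap : (h : B → ℕ) (k : A → List B) (xs : List A) →
  sum (map h (concatMap k xs)) ≡ sum (map (λ x → sum (map h (k x))) xs)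
sum-map-concatMap h k [] = refl
sum-map-concatMap h k (x ∷ xs) = begin
  sum (map h (k x ++ concatMap k xs))               ≡⟨ cong sum (map-++ h (k x) _) ⟩
  sum (map h (k x) ++ map h (concatMap k xs))       ≡⟨ sum-++ (map h (k x)) _ ⟩
  sum (map h (k x)) + sum (map h (concatMap k xs))  ≡⟨ cong (λ s → sum (map h (k x)) + s) (sum-map-concatMap h k xs) ⟩
  sum (map h (k x)) + sum (map (λ x → sum (map h (k x))) xs) ∎

sum-map-linear : ∀ a b (h k : A → ℕ) xs →
  sum (map (λ x → a * h x + b * k x) xs) ≡ a * sum (map h xs) + b * sum (map k xs)
sum-map-linear a b h k [] = sym (cong₂ _+_ (ℕ.*-zeroʳ a) (ℕ.*-zeroʳ b))
sum-map-linear a b h k (x ∷ xs) rewrite sum-map-linear a b h k xs =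
  solve 6 (λ a b h k H K → (a :* h :+ b :* k) :+ (a :* H :+ b :* K) := a :* (h :+ H) :+ b :* (k :+ K))
    refl a b (h x) (k x) (sum (map h xs)) (sum (map k xs))

sum-map-zero : (xs : List A) → sum (map (λ _ → 0) xs) ≡ 0
sum-map-zero [] = refl
sum-map-zero (x ∷ xs) = sum-map-zero xs

δ : ℕ → ℕ → ℕ
δ a b = if a ≡ᵇ b then 1 else 0

sum-map-filter : (f : A → ℕ) (r : ℕ) (t : A → ℕ) (xs : List A) →
  sum (map t (filter (λ x → f x ℕ.≟ r) xs)) ≡ sum (map (λ x → δ (f x) r * t x) xs)
sum-map-filter f r t [] = refl
sum-map-filter f r t (x ∷ xs) with f x ≡ᵇ r
... | true = cong₂ _+_ (sym (ℕ.+-identityʳ (t x))) (sum-map-filter f r t xs)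
... | false = sum-map-filter f r t xs

tabulate-+ : ∀ a {b} (h : Fin (a + b) → A) → tabulate h ≡ tabulate (h ∘ (_↑ˡ b)) ++ tabulate (h ∘ (a ↑ʳ_))
tabulate-+ zero h = refl
tabulate-+ (suc a) h = cong (h F.zero ∷_) (tabulate-+ a (h ∘ F.suc))

toList-++ : ∀ {a b} (xs : Vector A a) (ys : Vector A b) → toList (xs ++ᶠ ys) ≡ toList xs ++ toList ys
toList-++ {a = a} xs ys = trans (tabulate-+ a (xs ++ᶠ ys))
  (cong₂ _++_ (tabulate-cong (lookup-++ˡ xs ys)) (tabulate-cong (lookup-++ʳ xs ys)))

infix 30 _₁ _₂
_₁ _₂ : Vector ℕ 2 → ℕ
u ₁ = u F.zero
u ₂ = u (F.suc F.zero)

-- coeff us r is the coefficient of xʳ in the product of the linear forms u ₁ x + u ₂ over us.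
coeff : List (Vector ℕ 2) → ℕ → ℕ
coeff []       zero    = 1
coeff []       (suc r) = 0
coeff (u ∷ us) zero    = u ₂ * coeff us zero
coeff (u ∷ us) (suc r) = u ₁ * coeff us r + u ₂ * coeff us (suc r)

coeff-∷-cong : ∀ u {us ws} → coeff us ≗ coeff ws → coeff (u ∷ us) ≗ coeff (u ∷ ws)
coeff-∷-cong u eq zero    = cong (u ₂ *_) (eq zero)
coeff-∷-cong u eq (suc r) = cong₂ (λ a b → u ₁ * a + u ₂ * b) (eq r) (eq (suc r))

coeff-swap : ∀ u w us → coeff (u ∷ w ∷ us) ≗ coeff (w ∷ u ∷ us)
coeff-swap u w us zero =
  solve 3 (λ a b c → a :* (b :* c) := b :* (a :* c)) refl (u ₂) (w ₂) (coeff us 0)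
coeff-swap u w us (suc zero) =
  solve 6 (λ a₁ a₂ b₁ b₂ c d → a₁ :* (b₂ :* c) :+ a₂ :* (b₁ :* c :+ b₂ :* d) := b₁ :* (a₂ :* c) :+ b₂ :* (a₁ :* c :+ a₂ :* d))
    refl (u ₁) (u ₂) (w ₁) (w ₂) (coeff us 0) (coeff us 1)
coeff-swap u w us (suc (suc r)) =
  solve 7 (λ a₁ a₂ b₁ b₂ c d e → a₁ :* (b₁ :* c :+ b₂ :* d) :+ a₂ :* (b₁ :* d :+ b₂ :* e)
                              := b₁ :* (a₁ :* c :+ a₂ :* d) :+ b₂ :* (a₁ :* d :+ a₂ :* e))
    refl (u ₁) (u ₂) (w ₁) (w ₂) (coeff us r) (coeff us (suc r)) (coeff us (suc (suc r)))

coeff-++-∷ : ∀ xs u ys → coeff (xs ++ u ∷ ys) ≗ coeff (u ∷ xs ++ ys)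
coeff-++-∷ []       u ys r = refl
coeff-++-∷ (x ∷ xs) u ys r =
  trans (coeff-∷-cong x (coeff-++-∷ xs u ys) r) (coeff-swap x u (xs ++ ys) r)

isFirst : Fin 2 → ℕ
isFirst F.zero    = 1
isFirst (F.suc _) = 0

ones : ∀ {m} → (Fin m → Fin 2) → ℕ
ones I = sum (tabulate (isFirst ∘ I))

-- The indicator used by numOnes is local to its where block; the mutual block lets
-- unification name it in the type of numOnes-pointwise.
mutual
  numOnes≡ones : ∀ {m} (I : Fin m → Fin 2) → numOnes I ≡ ones I
  numOnes≡ones {m} I =
    cong sum (trans (map-cong (numOnes-pointwise I) (allFin m)) (map-tabulate (λ i → i) (isFirst ∘ I)))

  numOnes-pointwise : ∀ {m} (I : Fin m → Fin 2) i → _ ≡ isFirst (I i)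
  numOnes-pointwise I i with I i
  ... | F.zero       = refl
  ... | F.suc F.zero = refl

weight : ∀ {m} → Vector (Vector ℕ 2) m → (Fin m → Fin 2) → ℕ
weight F I = product (tabulate (λ i → F i (I i)))

balancedSum : ∀ m → Vector (Vector ℕ 2) m → ℕ → ℕ
balancedSum m F r = sum (map (λ I → δ (ones I) r * weight F I) (allIdx m))

balancedSum-suc : ∀ m (F : Vector (Vector ℕ 2) (suc m)) r →
  balancedSum (suc m) F r ≡
    F F.zero ₁ * sum (map (λ I → δ (suc (ones I)) r * weight (F ∘ F.suc) I) (allIdx m))
  + F F.zero ₂ * balancedSum m (F ∘ F.suc) r
balancedSum-suc m F r = begin
  balancedSum (suc m) F r
    ≡⟨ sum-map-concatMap _ _ (allIdx m) ⟩
  sum (map (λ I → term (F.zero ∷ᶠ I) + (term (F.suc F.zero ∷ᶠ I) + 0)) (allIdx m))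
    ≡⟨ cong sum (map-cong split (allIdx m)) ⟩
  sum (map (λ I → F F.zero ₁ * (δ (suc (ones I)) r * W I) + F F.zero ₂ * (δ (ones I) r * W I)) (allIdx m))
    ≡⟨ sum-map-linear (F F.zero ₁) (F F.zero ₂) _ _ (allIdx m) ⟩
  _ ∎
  where
  term : (Fin (suc m) → Fin 2) → ℕ
  term I = δ (ones I) r * weight F I
  W : (Fin m → Fin 2) → ℕ
  W = weight (F ∘ F.suc)
  split : ∀ I → term (F.zero ∷ᶠ I) + (term (F.suc F.zero ∷ᶠ I) + 0)
              ≡ F F.zero ₁ * (δ (suc (ones I)) r * W I) + F F.zero ₂ * (δ (ones I) r * W I)
  split I =
    solve 5 (λ a b x y w → a :* (x :* w) :+ (b :* (y :* w) :+ con 0) := x :* (a :* w) :+ y :* (b :* w))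
      refl (δ (suc (ones I)) r) (δ (ones I) r) (F F.zero ₁) (F F.zero ₂) (W I)

balancedSum≡coeff : ∀ m (F : Vector (Vector ℕ 2) m) r → balancedSum m F r ≡ coeff (toList F) r
balancedSum≡coeff zero    F zero    = refl
balancedSum≡coeff zero    F (suc r) = refl
balancedSum≡coeff (suc m) F zero    = begin
  balancedSum (suc m) F 0                                     ≡⟨ balancedSum-suc m F 0 ⟩
  F F.zero ₁ * sum (map (λ _ → 0) (allIdx m)) + F F.zero ₂ * S ≡⟨ cong (λ s → F F.zero ₁ * s + F F.zero ₂ * S) (sum-map-zero (allIdx m)) ⟩
  F F.zero ₁ * 0 + F F.zero ₂ * S                              ≡⟨ cong₂ _+_ (ℕ.*-zeroʳ (F F.zero ₁)) (cong (F F.zero ₂ *_) (balancedSum≡coeff m (F ∘ F.suc) 0)) ⟩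
  coeff (toList F) 0                                          ∎
  where
  S : ℕ
  S = balancedSum m (F ∘ F.suc) 0
balancedSum≡coeff (suc m) F (suc r) = trans (balancedSum-suc m F (suc r))
  (cong₂ (λ a b → F F.zero ₁ * a + F F.zero ₂ * b) (balancedSum≡coeff m _ r) (balancedSum≡coeff m _ (suc r)))

weight-++ : ∀ {a b} (L : Vector (Vector ℕ 2) a) (R : Vector (Vector ℕ 2) b) I →
  weight (L ++ᶠ R) I ≡ product (map (λ i → L i (I (i ↑ˡ b))) (allFin a))
                     * product (map (λ j → R j (I (a ↑ʳ j))) (allFin b))
weight-++ {a} {b} L R I = begin
  product (tabulate h)                                                 ≡⟨ cong product (tabulate-+ a h) ⟩
  product (tabulate (h ∘ (_↑ˡ b)) ++ tabulate (h ∘ (a ↑ʳ_)))             ≡⟨ product-++ (tabulate (h ∘ (_↑ˡ b))) _ ⟩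
  product (tabulate (h ∘ (_↑ˡ b))) * product (tabulate (h ∘ (a ↑ʳ_)))   ≡⟨ cong₂ (λ xs ys → product xs * product ys) left right ⟩
  _ ∎
  where
  h : Fin (a + b) → ℕ
  h i = (L ++ᶠ R) i (I i)
  left : tabulate (h ∘ (_↑ˡ b)) ≡ map (λ i → L i (I (i ↑ˡ b))) (allFin a)
  left = trans (tabulate-cong (λ i → cong-app (lookup-++ˡ L R i) (I (i ↑ˡ b)))) (sym (map-tabulate (λ i → i) _))
  right : tabulate (h ∘ (a ↑ʳ_)) ≡ map (λ j → R j (I (a ↑ʳ j))) (allFin b)
  right = trans (tabulate-cong (λ j → cong-app (lookup-++ʳ L R j) (I (a ↑ʳ j)))) (sym (map-tabulate (λ i → i) _))

theSum≡coeff : ∀ {p} n (v : Fin (n + (n + n)) → Vec2 p) (g : Fin n → Fin (n + n)) →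
  theSum n v g ≡ coeff (toList (λ (i : Fin n) → toℕ ∘ v (i ↑ˡ (n + n))) ++ toList (λ j → toℕ ∘ v (n ↑ʳ g j))) n
theSum≡coeff n v g = begin
  theSum n v g
    ≡⟨ sum-map-filter numOnes n _ (allIdx (n + n)) ⟩
  sum (map (λ I → δ (numOnes I) n * _) (allIdx (n + n)))
    ≡⟨ cong sum (map-cong (λ I → cong₂ (λ c t → δ c n * t) (numOnes≡ones I) (sym (weight-++ L R I))) (allIdx (n + n))) ⟩
  balancedSum (n + n) (L ++ᶠ R) n
    ≡⟨ balancedSum≡coeff (n + n) (L ++ᶠ R) n ⟩
  coeff (toList (L ++ᶠ R)) n
    ≡⟨ cong (λ ws → coeff ws n) (toList-++ L R) ⟩
  coeff (toList L ++ toList R) n ∎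
  where
  L R : Vector (Vector ℕ 2) n
  L i = toℕ ∘ v (i ↑ˡ (n + n))
  R j = toℕ ∘ v (n ↑ʳ g j)

-- Linear algebra over 𝔽_p

det : Vector ℕ 2 → Vector ℕ 2 → ℤ
det u w = + u ₁ ℤ.* + w ₂ ℤ.- + u ₂ ℤ.* + w ₁

module ModPrime {p : ℕ} (p-prime : Prime p) where

  instance
    p≢0 : NonZero p
    p≢0 = prime⇒nonZero p-prime

  euclid-∤ʳ : ∀ x a → + p ∣ᶻ x ℤ.* + a → ¬ p ∣ a → + p ∣ᶻ x
  euclid-∤ʳ x a p∣xa p∤a with euclidsLemma ℤ.∣ x ∣ a p-prime (subst (p ∣_) (ℤ.abs-* x (+ a)) (∣⇒∣ᵤ p∣xa))
  ... | inj₁ p∣x = ∣ᵤ⇒∣ p∣x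
  ... | inj₂ p∣a = ⊥-elim (p∤a p∣a)

  p∣toℕ⇒≡0 : (a : Fin p) → p ∣ toℕ a → toℕ a ≡ 0
  p∣toℕ⇒≡0 a p∣a with toℕ a | ℕ.<⇒≱ (Fin.toℕ<n a)
  ... | zero  | _   = refl
  ... | suc b | p≰a = ⊥-elim (p≰a (∣⇒≤ p∣a))

  p∤coeff₀ : ∀ {us} → All (λ u → ¬ p ∣ u ₂) us → ¬ p ∣ coeff us 0
  p∤coeff₀ []            p∣1   = nonTrivial⇒≢1 {{prime⇒nonTrivial p-prime}} (∣1⇒≡1 p∣1)
  p∤coeff₀ (p∤u₂ ∷ p∤us) p∣u₂c with euclidsLemma _ _ p-prime p∣u₂c
  ... | inj₁ p∣u₂ = p∤u₂ p∣u₂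
  ... | inj₂ p∣c  = p∤coeff₀ p∤us p∣c

  residue : (z : ℤ) → Σ (Fin p) λ c → + p ∣ᶻ + toℕ c ℤ.- z
  residue z = F.fromℕ< (n%ℕd<d z p) , subst (+ p ∣ᶻ_) (sym eq) (∣m⇒∣-m (∣n⇒∣m*n (z /ℕ p) ∣-refl))
    where
    eq : + toℕ (F.fromℕ< (n%ℕd<d z p)) ℤ.- z ≡ ℤ.- ((z /ℕ p) ℤ.* + p)
    eq = begin
      + toℕ (F.fromℕ< (n%ℕd<d z p)) ℤ.- z       ≡⟨ cong (λ r → + r ℤ.- z) (Fin.toℕ-fromℕ< (n%ℕd<d z p)) ⟩
      + (z %ℕ p) ℤ.- z                         ≡⟨ cong (λ y → + (z %ℕ p) ℤ.- y) (a≡a%ℕn+[a/ℕn]*n z p) ⟩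
      + (z %ℕ p) ℤ.- (+ (z %ℕ p) ℤ.+ (z /ℕ p) ℤ.* + p) ≡⟨ x-[x+y]≡-y (+ (z %ℕ p)) _ ⟩
      ℤ.- ((z /ℕ p) ℤ.* + p) ∎
      where
      x-[x+y]≡-y : ∀ x y → x ℤ.- (x ℤ.+ y) ≡ ℤ.- y
      x-[x+y]≡-y = solve-∀

  inverse : (a : Fin p) → toℕ a ≢ 0 → Σ ℤ λ x → + p ∣ᶻ x ℤ.* + toℕ a ℤ.- + 1
  inverse a a≢0 with coprime-Bézout (prime⇒coprime p-prime {{≢-nonZero a≢0}} (Fin.toℕ<n a))
  ... | Bézout.+- x y 1+ya≡xp = ℤ.- + y , subst (+ p ∣ᶻ_) (sym eq) (∣m⇒∣-m (∣ᵤ⇒∣ (n∣m*n x)))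
    where
    eq : ℤ.- + y ℤ.* + toℕ a ℤ.- + 1 ≡ ℤ.- + (x * p)
    eq = begin
      ℤ.- + y ℤ.* + toℕ a ℤ.- + 1       ≡⟨ -yb-1≡-[1+yb] (+ y) (+ toℕ a) ⟩
      ℤ.- (+ 1 ℤ.+ + y ℤ.* + toℕ a)     ≡⟨ cong (λ z → ℤ.- (+ 1 ℤ.+ z)) (ℤ.pos-* y (toℕ a)) ⟨
      ℤ.- + (1 + y * toℕ a)             ≡⟨ cong (λ m → ℤ.- + m) 1+ya≡xp ⟩
      ℤ.- + (x * p)                     ∎
      where
      -yb-1≡-[1+yb] : ∀ y b → ℤ.- y ℤ.* b ℤ.- + 1 ≡ ℤ.- (+ 1 ℤ.+ y ℤ.* b)
      -yb-1≡-[1+yb] = solve-∀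
  ... | Bézout.-+ x y 1+xp≡ya = + y , subst (+ p ∣ᶻ_) (sym eq) (∣ᵤ⇒∣ (n∣m*n x))
    where
    eq : + y ℤ.* + toℕ a ℤ.- + 1 ≡ + (x * p)
    eq = begin
      + y ℤ.* + toℕ a ℤ.- + 1   ≡⟨ cong (λ z → z ℤ.- + 1) (ℤ.pos-* y (toℕ a)) ⟨
      + (y * toℕ a) ℤ.- + 1     ≡⟨ cong (λ m → + m ℤ.- + 1) 1+xp≡ya ⟨
      + (x * p)                 ∎

  p∣i-i : ∀ i → + p ∣ᶻ i ℤ.- i
  p∣i-i i = subst (+ p ∣ᶻ_) (sym (ℤ.+-inverseʳ i)) (∣ᵤ⇒∣ (p ∣0))

  pos-linear : ∀ x a y b → + (x * a + y * b) ≡ + x ℤ.* + a ℤ.+ + y ℤ.* + b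
  pos-linear x a y b = trans (ℤ.pos-+ (x * a) (y * b)) (cong₂ ℤ._+_ (ℤ.pos-* x a) (ℤ.pos-* y b))

  det-annihilates : ∀ u w a b → p ∣ u ₁ * a + u ₂ * b → p ∣ w ₁ * a + w ₂ * b →
    + p ∣ᶻ det u w ℤ.* + a × + p ∣ᶻ det u w ℤ.* + b
  det-annihilates u w a b p∣ua p∣wa =
      subst (+ p ∣ᶻ_) (sym (det*a (+ u ₁) (+ u ₂) (+ w ₁) (+ w ₂) (+ a) (+ b))) (∣m∣n⇒∣m-n (∣n⇒∣m*n (+ w ₂) ua) (∣n⇒∣m*n (+ u ₂) wa))
    , subst (+ p ∣ᶻ_) (sym (det*b (+ u ₁) (+ u ₂) (+ w ₁) (+ w ₂) (+ a) (+ b))) (∣m∣n⇒∣m-n (∣n⇒∣m*n (+ u ₁) wa) (∣n⇒∣m*n (+ w ₁) ua))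
    where
    ua : + p ∣ᶻ + u ₁ ℤ.* + a ℤ.+ + u ₂ ℤ.* + b
    ua = subst (+ p ∣ᶻ_) (pos-linear (u ₁) a (u ₂) b) (∣ᵤ⇒∣ p∣ua)
    wa : + p ∣ᶻ + w ₁ ℤ.* + a ℤ.+ + w ₂ ℤ.* + b
    wa = subst (+ p ∣ᶻ_) (pos-linear (w ₁) a (w ₂) b) (∣ᵤ⇒∣ p∣wa)
    det*a : ∀ u₁ u₂ w₁ w₂ a b →
      (u₁ ℤ.* w₂ ℤ.- u₂ ℤ.* w₁) ℤ.* a ≡ w₂ ℤ.* (u₁ ℤ.* a ℤ.+ u₂ ℤ.* b) ℤ.- u₂ ℤ.* (w₁ ℤ.* a ℤ.+ w₂ ℤ.* b)
    det*a = solve-∀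
    det*b : ∀ u₁ u₂ w₁ w₂ a b →
      (u₁ ℤ.* w₂ ℤ.- u₂ ℤ.* w₁) ℤ.* b ≡ u₁ ℤ.* (w₁ ℤ.* a ℤ.+ w₂ ℤ.* b) ℤ.- w₁ ℤ.* (u₁ ℤ.* a ℤ.+ u₂ ℤ.* b)
    det*b = solve-∀

  common-root⇒det : ∀ u w a b → p ∣ u ₁ * a + u ₂ * b → p ∣ w ₁ * a + w ₂ * b →
    ¬ p ∣ a ⊎ ¬ p ∣ b → + p ∣ᶻ det u w
  common-root⇒det u w a b p∣ua p∣wa (inj₁ p∤a) = euclid-∤ʳ (det u w) a (proj₁ (det-annihilates u w a b p∣ua p∣wa)) p∤a
  common-root⇒det u w a b p∣ua p∣wa (inj₂ p∤b) = euclid-∤ʳ (det u w) b (proj₂ (det-annihilates u w a b p∣ua p∣wa)) p∤b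

  det-minor : ∀ u w → + p ∣ᶻ det u w → ∀ k t → + p ∣ᶻ + u k ℤ.* + w t ℤ.- + u t ℤ.* + w k
  det-minor u w p∣det F.zero       F.zero       = p∣i-i (+ u ₁ ℤ.* + w ₁)
  det-minor u w p∣det F.zero       (F.suc F.zero) = p∣det
  det-minor u w p∣det (F.suc F.zero) F.zero     =
    subst (+ p ∣ᶻ_) (swap-sub (+ u ₁ ℤ.* + w ₂) (+ u ₂ ℤ.* + w ₁)) (∣m⇒∣-m p∣det)
    where
    swap-sub : ∀ x y → ℤ.- (x ℤ.- y) ≡ y ℤ.- x
    swap-sub = solve-∀
  det-minor u w p∣det (F.suc F.zero) (F.suc F.zero) = p∣i-i (+ u ₂ ℤ.* + w ₂)

  nonzero-coordinate : (w : Vec2 p) → NonZeroVec w → Σ (Fin 2) λ t → toℕ (w t) ≢ 0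
  nonzero-coordinate w w≢0 with toℕ (w F.zero) ℕ.≟ 0 | toℕ (w (F.suc F.zero)) ℕ.≟ 0
  ... | no  w₁≢0 | _          = F.zero , w₁≢0
  ... | yes _    | no w₂≢0    = F.suc F.zero , w₂≢0
  ... | yes w₁≡0 | yes w₂≡0   = ⊥-elim (w≢0 λ { F.zero → w₁≡0 ; (F.suc F.zero) → w₂≡0 })

  det≡0⇒SameClass : (u w : Vec2 p) → NonZeroVec u → NonZeroVec w →
    + p ∣ᶻ det (toℕ ∘ u) (toℕ ∘ w) → SameClass u w
  det≡0⇒SameClass u w u≢0 w≢0 p∣det with nonzero-coordinate w w≢0
  ... | t , wₜ≢0 with inverse (w t) wₜ≢0
  ... | x , x-inverse with residue (+ toℕ (u t) ℤ.* x)
  ... | c , c-residue = c , c≢0 , λ k → ∣⇒∣ᵤ (subst (λ z → + p ∣ᶻ U k ℤ.- z) (sym (ℤ.pos-* (toℕ c) (toℕ (w k)))) (u≡cw k))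
    where
    U W : Fin 2 → ℤ
    U k = + toℕ (u k)
    W k = + toℕ (w k)
    -- x inverts wₜ and c ≡ uₜ x, so uₖ − c wₖ is a combination of the three vanishing quantities.
    u≡cw : ∀ k → + p ∣ᶻ U k ℤ.- + toℕ c ℤ.* W k
    u≡cw k = subst (+ p ∣ᶻ_) (sym (identity (U k) (W k) (U t) (W t) x (+ toℕ c)))
      (∣m∣n⇒∣m+n (∣m∣n⇒∣m+n (∣n⇒∣m*n (ℤ.- U k) x-inverse)
                             (∣n⇒∣m*n x (det-minor (toℕ ∘ u) (toℕ ∘ w) p∣det k t)))
                 (∣n⇒∣m*n (ℤ.- W k) c-residue))
      where
      identity : ∀ uₖ wₖ uₜ wₜ x c → uₖ ℤ.- c ℤ.* wₖ ≡
        (ℤ.- uₖ) ℤ.* (x ℤ.* wₜ ℤ.- + 1) ℤ.+ x ℤ.* (uₖ ℤ.* wₜ ℤ.- uₜ ℤ.* wₖ) ℤ.+ (ℤ.- wₖ) ℤ.* (c ℤ.- uₜ ℤ.* x)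
      identity = solve-∀
    c≢0 : toℕ c ≢ 0
    c≢0 c≡0 = u≢0 λ k → p∣toℕ⇒≡0 (u k) (∣⇒∣ᵤ
      (subst (+ p ∣ᶻ_) (ℤ.+-identityʳ (U k)) (subst (λ m → + p ∣ᶻ U k ℤ.- + m ℤ.* W k) c≡0 (u≡cw k))))

-- The greedy choice

straddle : ∀ {k i n} → k < n → k ≤ i → i ≤ n → Σ ℕ λ r → k ≤ r × r < n × (i ≡ r ⊎ i ≡ suc r)
straddle {i = i} {n} k<n k≤i i≤n with i ℕ.<? n
... | yes i<n = i , k≤i , i<n , inj₁ refl
straddle {n = suc r} (s≤s k≤r) k≤i i≤n | no i≮n = r , k≤r , ℕ.≤-refl , inj₂ (ℕ.≤-antisym i≤n (ℕ.≮⇒≥ i≮n))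

module Window {p : ℕ} (p-prime : Prime p) (n : ℕ) where
  open ModPrime p-prime

  Alive : ℕ → (ℕ → ℕ) → Set
  Alive k c = Σ (Fin (suc n)) λ i → k ≤ toℕ i × ¬ p ∣ c (toℕ i)

  alive? : ∀ k c → Dec (Alive k c)
  alive? k c = Fin.any? λ i → (k ℕ.≤? toℕ i) ×-dec ¬? (p ∣? c (toℕ i))

  Alive-cong : ∀ {k c c′} → c ≗ c′ → Alive k c → Alive k c′
  Alive-cong c≗c′ (i , k≤i , p∤cᵢ) = i , k≤i , p∤cᵢ ∘ subst (p ∣_) (sym (c≗c′ (toℕ i)))

  dead⇒∣ : ∀ {k} c {i} → ¬ Alive k c → k ≤ i → i ≤ n → p ∣ c i
  dead⇒∣ {k} c {i} dead k≤i i≤n with p ∣? c i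
  ... | yes p∣cᵢ = p∣cᵢ
  ... | no  p∤cᵢ = ⊥-elim (dead (F.fromℕ< (s≤s i≤n) , subst (k ≤_) (sym toℕ-i) k≤i , subst (λ j → ¬ p ∣ c j) (sym toℕ-i) p∤cᵢ))
    where toℕ-i = Fin.toℕ-fromℕ< (s≤s i≤n)

  alive-top : ∀ c → Alive n c → ¬ p ∣ c n
  alive-top c (i , n≤i , p∤cᵢ) = subst (λ j → ¬ p ∣ c j) (ℕ.≤-antisym (ℕ.≤-pred (Fin.toℕ<n i)) n≤i) p∤cᵢ

  -- Writing an alive index as r or r + 1 with k ≤ r < n, the pair (cᵣ, cᵣ₊₁) of ws is nonzero
  -- mod p and, by the recursion of coeff, a common root of the linear forms of u and w.
  dead-extensions⇒det : ∀ {k} ws u w → k < n → Alive k (coeff ws) →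
    ¬ Alive (suc k) (coeff (u ∷ ws)) → ¬ Alive (suc k) (coeff (w ∷ ws)) → + p ∣ᶻ det u w
  dead-extensions⇒det ws u w k<n (i , k≤i , p∤cᵢ) dead-u dead-w
    with straddle k<n k≤i (ℕ.≤-pred (Fin.toℕ<n i))
  ... | r , k≤r , r<n , i≡r⊎i≡1+r =
    common-root⇒det u w (coeff ws r) (coeff ws (suc r))
      (dead⇒∣ (coeff (u ∷ ws)) dead-u (s≤s k≤r) r<n) (dead⇒∣ (coeff (w ∷ ws)) dead-w (s≤s k≤r) r<n)
      (Sum.map moved moved i≡r⊎i≡1+r)
    where
    moved : ∀ {j} → toℕ i ≡ j → ¬ p ∣ coeff ws j
    moved i≡j = subst (λ m → ¬ p ∣ coeff ws m) i≡j p∤cᵢ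

∷-injective : ∀ {k} {g : Fin k → A} {x} → Injective _≡_ _≡_ g → (∀ i → g i ≢ x) → Injective _≡_ _≡_ (x ∷ᶠ g)
∷-injective g-inj x∉g {F.zero}  {F.zero}  _   = refl
∷-injective g-inj x∉g {F.zero}  {F.suc j} x≡g = ⊥-elim (x∉g j (sym x≡g))
∷-injective g-inj x∉g {F.suc i} {F.zero}  g≡x = ⊥-elim (x∉g i g≡x)
∷-injective g-inj x∉g {F.suc i} {F.suc j} g≡g = cong F.suc (g-inj g≡g)

module Greedy {p : ℕ} (p-prime : Prime p) (n : ℕ) (v : Fin (n + (n + n)) → Vec2 p)
  (v≢0 : ∀ i → NonZeroVec (v i))
  (no-large-class : ¬ (Σ (Fin (suc n) → Fin (n + (n + n))) λ f →
                        Injective _≡_ _≡_ f × (∀ a b → SameClass (v (f a)) (v (f b)))))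
  where
  open ModPrime p-prime
  open Window p-prime n

  fixed : Vector (Vector ℕ 2) n
  fixed i = toℕ ∘ v (i ↑ˡ (n + n))

  candidate : Fin (n + n) → Vector ℕ 2
  candidate j = toℕ ∘ v (n ↑ʳ j)

  factors : ∀ {k} → (Fin k → Fin (n + n)) → List (Vector ℕ 2)
  factors g = toList fixed ++ toList (candidate ∘ g)

  record Selection (k d : ℕ) : Set where
    field
      chosen           : Fin k → Fin (n + n)
      unused           : Fin (d + n) → Fin (n + n)
      chosen-injective : Injective _≡_ _≡_ chosen
      unused-injective : Injective _≡_ _≡_ unused
      disjoint         : ∀ i j → chosen i ≢ unused j
      alive            : Alive k (coeff (factors chosen))

  start : (∀ i → toℕ (v (i ↑ˡ (n + n)) (F.suc F.zero)) ≢ 0) → Selection 0 n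
  start v₂≢0 = record
    { chosen           = λ ()
    ; unused           = λ j → j
    ; chosen-injective = λ { {()} }
    ; unused-injective = λ j≡j′ → j≡j′
    ; disjoint         = λ ()
    ; alive            = F.zero , z≤n , p∤coeff₀ (subst (All _) (sym (++-identityʳ (toList fixed))) (tabulate⁺ p∤fixed₂))
    }
    where
    p∤fixed₂ : ∀ i → ¬ p ∣ fixed i ₂
    p∤fixed₂ i = v₂≢0 i ∘ p∣toℕ⇒≡0 _

  extend : ∀ {k d} → k < n → Selection k (suc d) → Selection (suc k) d
  extend {k} {d} k<n s with Fin.any? (λ j → alive? (suc k) (coeff (factors (unused j ∷ᶠ chosen))))
    where open Selection s
  ... | yes (j , alive′) = record
    { chosen           = unused j ∷ᶠ chosen
    ; unused           = unused ∘ F.punchIn j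
    ; chosen-injective = ∷-injective chosen-injective (λ i → disjoint i j)
    ; unused-injective = Fin.punchIn-injective j _ _ ∘ unused-injective
    ; disjoint         = λ { F.zero j′ → Fin.punchInᵢ≢i j j′ ∘ sym ∘ unused-injective
                           ; (F.suc i) j′ → disjoint i (F.punchIn j j′) }
    ; alive            = alive′
    }
    where open Selection s
  ... | no none = ⊥-elim (no-large-class (f , f-injective , λ a b →
          det≡0⇒SameClass (v (f a)) (v (f b)) (v≢0 (f a)) (v≢0 (f b))
            (dead-extensions⇒det (factors chosen) _ _ k<n alive (dead a) (dead b))))
    where
    open Selection s
    n<d+n : suc n ≤ suc d + n
    n<d+n = s≤s (ℕ.m≤n+m n d)
    f : Fin (suc n) → Fin (n + (n + n))
    f a = n ↑ʳ unused (F.inject≤ a n<d+n)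
    f-injective : Injective _≡_ _≡_ f
    f-injective {a} {b} = Fin.inject≤-injective n<d+n n<d+n a b ∘ unused-injective ∘ Fin.↑ʳ-injective n _ _
    dead : ∀ a → ¬ Alive (suc k) (coeff (candidate (unused (F.inject≤ a n<d+n)) ∷ factors chosen))
    dead a = none ∘ (F.inject≤ a n<d+n ,_) ∘ Alive-cong (λ r → sym (coeff-++-∷ (toList fixed) _ _ r))

  select : ∀ d {k} → k + d ≡ n → Selection k d → Selection n 0
  select zero    {k} k+0≡n s = subst (λ m → Selection m 0) (trans (sym (ℕ.+-identityʳ k)) k+0≡n) s
  select (suc d) {k} k+d≡n s = select d (trans (sym (ℕ.+-suc k d)) k+d≡n) (extend k<n s)
    where
    k<n : k < n
    k<n = subst (k <_) k+d≡n (ℕ.m<m+n k (s≤s z≤n))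

lemma7p2 : (p : ℕ) → Prime p → (n : ℕ) → 1 ≤ n →
    (v : Fin (n + (n + n)) → Vec2 p) →
    (∀ i → NonZeroVec (v i)) →
    (∀ (i : Fin n) → toℕ (v (i ↑ˡ (n + n)) (F.suc F.zero)) ≢ 0) →
    ¬ (Σ (Fin (ℕ.suc n) → Fin (n + (n + n))) λ f →
         Injective _≡_ _≡_ f × (∀ a b → SameClass (v (f a)) (v (f b)))) →
    Σ (Fin n → Fin (n + n)) λ g →
      Injective _≡_ _≡_ g × ¬ (p ∣ theSum n v g)
lemma7p2 p p-prime n _ v v≢0 v₂≢0 no-large-class =
  chosen , chosen-injective , alive-top (coeff (factors chosen)) alive ∘ subst (p ∣_) (theSum≡coeff n v chosen)
  where
  open Greedy p-prime n v v≢0 no-large-class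
  open Window p-prime n using (alive-top)
  open Selection (select n refl (start v₂≢0))
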